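{- For $\theta>0$, integers $N\ge1$ and $0\le k\le N$, let $W(N,k)=\sum_{k\text{ -winnable }\pi\in\mathfrak{S}_N}\theta^{\mathrm{inv}(\pi)}$. Then $W(1,0)=1$, $W(N,N)=0$, and for $N\ge2$ and $0\le k\le N-1$, $$W(N,k)=\theta[N-1]_\theta\,W(N-1,k)+\theta^{N-k-1}[k]_\theta\,[N-2]_\theta!.$$
   Context: $\mathrm{inv}(\pi)$ is the number of inversions of $\pi$ (pairs $i<j$ with $\pi_i>\pi_j$). $[n]_\theta=1+\theta+\cdots+\theta^{n-1}$ (so $[0]_\theta=0$) and $[n]_\theta!=[n]_\theta[n-1]_\theta\cdots[1]_\theta$ with $[0]_\theta!=1$. A permutation $\pi\in\mathfrak{S}_N$ is $k$-winnable if the strategy that rejects the first $k$ entries and then accepts the first subsequent entry larger than all previous entries selects the entry $N$.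
   Formalization: The parameter θ ranges over the positive rationals instead of the positive reals. -}

module Defs where

open import Data.Bool using (Bool; true; false; if_then_else_)
open import Data.Nat using (ℕ; zero; suc; _<ᵇ_; _<?_)
import Data.Nat.Properties as ℕP
import Data.Nat as ℕ
open import Data.Fin using (Fin; toℕ)
open import Data.Fin.Properties using (all?)
import Data.Fin.Properties as FinP
open import Data.List using (List; []; _∷_; [_]; length; filter; concatMap; map; allFin; foldr)
open import Data.Maybe using (Maybe; just; nothing)
import Data.Maybe.Properties as MaybeP
open import Data.Rational using (ℚ; 0ℚ; 1ℚ; _+_; _*_)
open import Relation.Nullary using (does)
import Data.List.Relation.Unary.Unique.DecPropositional as UniqueDec

pow : ℚ → ℕ → ℚ
pow θ zero = 1ℚ
pow θ (suc n) = θ * pow θ n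

qint : ℚ → ℕ → ℚ
qint θ zero = 0ℚ
qint θ (suc n) = qint θ n + pow θ n

qfact : ℚ → ℕ → ℚ
qfact θ zero = 1ℚ
qfact θ (suc n) = qint θ (suc n) * qfact θ n

allWords : (n m : ℕ) → List (List (Fin m))
allWords zero m = [ [] ]
allWords (suc n) m = concatMap (λ i → map (i ∷_) (allWords n m)) (allFin m)

-- The symmetric group S_N, as the list of all permutations in one-line
-- notation π = π_1 π_2 ... π_N with values in {1,...,N}: words of length N
-- over Fin N with pairwise distinct entries, shifted by one (value i ↦ i+1).
perms : ℕ → List (List ℕ)
perms N = map (map (λ i → suc (toℕ i)))
              (filter (UniqueDec.unique? FinP._≟_) (allWords N N))

inv : List ℕ → ℕ
inv [] = 0
inv (x ∷ xs) = length (filter (_<? x) xs) ℕ.+ inv xs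

updMax : Maybe ℕ → ℕ → Maybe ℕ
updMax nothing x = just x
updMax (just a) x = if a <ᵇ x then just x else just a

beatsAll : Maybe ℕ → ℕ → Bool
beatsAll nothing x = true
beatsAll (just a) x = a <ᵇ x

run : Maybe ℕ → ℕ → List ℕ → Maybe ℕ
run m r [] = nothing
run m (suc r) (x ∷ xs) = run (updMax m x) r xs
run m zero (x ∷ xs) = if beatsAll m x then just x else run (updMax m x) zero xs

-- Entry selected by the strategy rejecting the first k entries and then
-- accepting the first subsequent entry larger than all previous entries.
select : ℕ → List ℕ → Maybe ℕ
select k π = run nothing k π

winnable? : ℕ → ℕ → List ℕ → Bool
winnable? N k π = does (MaybeP.≡-dec ℕP._≟_ (select k π) (just N))

W : ℚ → ℕ → ℕ → ℚ
W θ N k = foldr (λ π acc → (if winnable? N k π then pow θ (inv π) else 0ℚ) + acc)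
                0ℚ (perms N)

-- Every π ∈ S_{n+1} arises exactly once as extend v σ: append v ∈ [1, n+1] to σ ∈ S_n after
-- raising the entries ≥ v of σ by one, which adds n + 1 − v inversions.  Raising preserves the
-- relative order, so on the first n entries of extend v σ the strategy acts as on σ, and it can
-- accept the new last entry only if that entry is the maximum n + 1 and nothing of σ was accepted.
-- Writing Z(n,k) for the θ^inv-weighted count of the σ ∈ S_n on which nothing is accepted, summing
-- over v gives W(n+1,k) = Z(n,k) + θ[n] W(n,k) and Z(n+1,k) = θ[n] Z(n,k) for k ≤ n, while
-- Z(k,k) = [k]! is the inversion generating function of S_k; so Z(n,k) = θ^(n−k) [k] [n−1]! for n ≥ 1.

module Submission where

open import Defs
open import Algebra.Bundles using (CommutativeMonoid)
open import Data.Bool using (Bool; true; false; if_then_else_)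
open import Data.Empty using (⊥-elim)
open import Data.Fin using (Fin; toℕ; fromℕ<)
import Data.Fin.Properties as Fin
open import Data.List
  using ( List; []; _∷_; [_]; _++_; _∷ʳ_; map; length; filter; concatMap; allFin; foldr; foldl
        ; applyDownFrom; initLast; _∷ʳ′_)
open import Data.List.Properties
  using ( length-map; length-++; filter-++; foldr-map; map-∘; map-id-local; map-injective
        ; ∷ʳ-injective; ∷-injectiveˡ; ∷-injectiveʳ)
open import Data.List.Membership.Propositional using (_∈_; lose; find)
open import Data.List.Membership.Propositional.Properties
  using ( ∈-++⁺ˡ; ∈-++⁺ʳ; ∈-allFin; ∈-applyDownFrom⁺; ∈-applyDownFrom⁻; ∈-concatMap⁺; ∈-concatMap⁻
        ; ∈-filter⁺; ∈-filter⁻; ∈-map⁺; ∈-map⁻)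
open import Data.List.Membership.Propositional.Properties.WithK using (unique∧set⇒bag)
open import Data.List.Relation.Binary.BagAndSetEquality using (∼bag⇒↭)
open import Data.List.Relation.Binary.Permutation.Propositional using (_↭_; ↭-sym; ↭⇒↭ₛ)
import Data.List.Relation.Binary.Permutation.Propositional.Properties as ↭
open import Data.List.Relation.Binary.Permutation.Setoid.Properties using (foldr-commMonoid)
open import Data.List.Relation.Unary.All using (All; []; _∷_)
import Data.List.Relation.Unary.All as All
import Data.List.Relation.Unary.All.Properties as All
import Data.List.Relation.Unary.AllPairs as AllPairs
import Data.List.Relation.Unary.AllPairs.Properties as AllPairs
open import Data.List.Relation.Unary.Any using (here; there)
import Data.List.Relation.Unary.Any as Any
open import Data.List.Relation.Unary.Unique.Propositional using (Unique)
import Data.List.Relation.Unary.Unique.Propositional.Properties as Unique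
import Data.List.Relation.Unary.Unique.DecPropositional as UniqueDec
open import Data.Maybe using (Maybe; just; nothing; is-nothing; _<∣>_)
import Data.Maybe as Maybe
import Data.Maybe.Properties as Maybe
import Data.Maybe.Relation.Unary.All as MaybeAll
import Data.Maybe.Relation.Unary.Any as MaybeAny
open import Data.Nat using (ℕ; zero; suc; pred; _≤_; _∸_; _<ᵇ_; _<?_; _≟_; z≤n; s≤s)
import Data.Nat as ℕ
open import Data.Nat.Properties
open import Data.Product using (∃₂; _×_; _,_; proj₂)
open import Data.Rational using (ℚ; 0ℚ; 1ℚ; _+_; _*_; _<_)
import Data.Rational.Properties as ℚ
open import Data.Rational.Solver using (module +-*-Solver)
open import Data.Sum using (inj₁; inj₂)
open import Function using (_∘_; const; _⇔_; mk⇔)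
open import Relation.Binary using (_Preserves_⟶_; tri<; tri≈; tri>)
open import Relation.Binary.PropositionalEquality
  using (_≡_; _≢_; refl; sym; trans; cong; cong₂; subst; setoid; module ≡-Reasoning)
open import Relation.Unary using (Decidable)
open import Relation.Nullary using (¬_; yes; no; does)
open import Relation.Nullary.Decidable using (dec-true; dec-false; does-⇔)
open import Data.List.Relation.Binary.Permutation.Setoid.Properties (setoid ℕ) using (Unique-resp-↭)

private module ℚ+ = CommutativeMonoid ℚ.+-0-commutativeMonoid

sumℚ : {A : Set} → (A → ℚ) → List A → ℚ
sumℚ f = foldr (λ x s → f x + s) 0ℚ

module _ {A : Set} where

  sumℚ-↭ : (f : A → ℚ) {xs ys : List A} → xs ↭ ys → sumℚ f xs ≡ sumℚ f ys
  sumℚ-↭ f {xs} {ys} p = begin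
    sumℚ f xs                ≡⟨ foldr-map _+_ f 0ℚ xs ⟨
    foldr _+_ 0ℚ (map f xs)  ≡⟨ foldr-commMonoid ℚ+.setoid ℚ+.isCommutativeMonoid (↭⇒↭ₛ (↭.map⁺ f p)) ⟩
    foldr _+_ 0ℚ (map f ys)  ≡⟨ foldr-map _+_ f 0ℚ ys ⟩
    sumℚ f ys                ∎
    where open ≡-Reasoning

  sumℚ-++ : (f : A → ℚ) (xs ys : List A) → sumℚ f (xs ++ ys) ≡ sumℚ f xs + sumℚ f ys
  sumℚ-++ f []       ys = sym (ℚ.+-identityˡ _)
  sumℚ-++ f (x ∷ xs) ys = trans (cong (f x +_) (sumℚ-++ f xs ys)) (sym (ℚ.+-assoc (f x) _ _))

  sumℚ-cong : {f g : A → ℚ} (xs : List A) → (∀ {x} → x ∈ xs → f x ≡ g x) → sumℚ f xs ≡ sumℚ g xs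
  sumℚ-cong []       f≗g = refl
  sumℚ-cong (x ∷ xs) f≗g = cong₂ _+_ (f≗g (here refl)) (sumℚ-cong xs (f≗g ∘ there))

  sumℚ-+ : (f g : A → ℚ) (xs : List A) → sumℚ (λ x → f x + g x) xs ≡ sumℚ f xs + sumℚ g xs
  sumℚ-+ f g []       = sym (ℚ.+-identityˡ 0ℚ)
  sumℚ-+ f g (x ∷ xs) = trans (cong (f x + g x +_) (sumℚ-+ f g xs))
                             (interchange (f x) (g x) (sumℚ f xs) (sumℚ g xs))
    where open import Algebra.Properties.CommutativeSemigroup ℚ+.commutativeSemigroup using (interchange)

  sumℚ-0 : (xs : List A) → sumℚ (λ _ → 0ℚ) xs ≡ 0ℚ
  sumℚ-0 []       = refl
  sumℚ-0 (x ∷ xs) = trans (cong (0ℚ +_) (sumℚ-0 xs)) (ℚ.+-identityˡ 0ℚ)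

  sumℚ-*ʳ : (f : A → ℚ) (c : ℚ) (xs : List A) → sumℚ (λ x → f x * c) xs ≡ sumℚ f xs * c
  sumℚ-*ʳ f c []       = sym (ℚ.*-zeroˡ c)
  sumℚ-*ʳ f c (x ∷ xs) = trans (cong (f x * c +_) (sumℚ-*ʳ f c xs)) (sym (ℚ.*-distribʳ-+ c (f x) _))

  sumℚ-*ˡ : (c : ℚ) (f : A → ℚ) (xs : List A) → sumℚ (λ x → c * f x) xs ≡ c * sumℚ f xs
  sumℚ-*ˡ c f xs = trans (sumℚ-cong xs (λ _ → ℚ.*-comm c _)) (trans (sumℚ-*ʳ f c xs) (ℚ.*-comm _ c))

unique∧set⇒↭ : {A : Set} {xs ys : List A} → Unique xs → Unique ys → (∀ {z} → z ∈ xs ⇔ z ∈ ys) → xs ↭ ys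
unique∧set⇒↭ xs! ys! xs≈ys = ∼bag⇒↭ (unique∧set⇒bag xs! ys! xs≈ys)

module _ {A B : Set} where

  sumℚ-map : (f : B → ℚ) (g : A → B) (xs : List A) → sumℚ f (map g xs) ≡ sumℚ (f ∘ g) xs
  sumℚ-map f g = foldr-map _ g 0ℚ

  sumℚ-concatMap : (f : B → ℚ) (g : A → List B) (xs : List A) →
                   sumℚ f (concatMap g xs) ≡ sumℚ (sumℚ f ∘ g) xs
  sumℚ-concatMap f g []       = refl
  sumℚ-concatMap f g (x ∷ xs) =
    trans (sumℚ-++ f (g x) (concatMap g xs)) (cong (sumℚ f (g x) +_) (sumℚ-concatMap f g xs))

  Unique-concatMap⁺ : {g : A → List B} {xs : List A} → Unique xs → (∀ x → Unique (g x)) →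
                      (∀ {x y z} → z ∈ g x → z ∈ g y → x ≡ y) → Unique (concatMap g xs)
  Unique-concatMap⁺ {g} {xs} xs! g! overlap⇒≡ =
    Unique.concat⁺ (All.map⁺ (All.universal g! xs))
                   (AllPairs.map⁺ (AllPairs.map (λ x≢y {_} (p , q) → x≢y (overlap⇒≡ p q)) xs!))

<ᵇ-true : ∀ {m n} → m ℕ.< n → (m <ᵇ n) ≡ true
<ᵇ-true {m} {n} = dec-true (m <? n)

<ᵇ-false : ∀ {m n} → ¬ m ℕ.< n → (m <ᵇ n) ≡ false
<ᵇ-false {m} {n} = dec-false (m <? n)

module _ {f : ℕ → ℕ} (f-mono : f Preserves ℕ._<_ ⟶ ℕ._<_) where

  strictMono-<ᵇ : ∀ x y → (f x <ᵇ f y) ≡ (x <ᵇ y)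
  strictMono-<ᵇ x y with <-cmp x y
  ... | tri< x<y _ _ = trans (<ᵇ-true (f-mono x<y)) (sym (<ᵇ-true x<y))
  ... | tri≈ x≮y refl _ = trans (<ᵇ-false (<-irrefl {f x} refl)) (sym (<ᵇ-false x≮y))
  ... | tri> x≮y _ y<x = trans (<ᵇ-false (<-asym (f-mono y<x))) (sym (<ᵇ-false x≮y))

  strictMono-injective : ∀ {x y} → f x ≡ f y → x ≡ y
  strictMono-injective {x} {y} fx≡fy with <-cmp x y
  ... | tri< x<y _ _ = ⊥-elim (<⇒≢ (f-mono x<y) fx≡fy)
  ... | tri≈ _ x≡y _ = x≡y
  ... | tri> _ _ y<x = ⊥-elim (<⇒≢ (f-mono y<x) (sym fx≡fy))

  updMax-map : ∀ m x → updMax (Maybe.map f m) (f x) ≡ Maybe.map f (updMax m x)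
  updMax-map nothing  x = refl
  updMax-map (just a) x rewrite strictMono-<ᵇ a x with a <ᵇ x
  ... | true  = refl
  ... | false = refl

  beatsAll-map : ∀ m x → beatsAll (Maybe.map f m) (f x) ≡ beatsAll m x
  beatsAll-map nothing  x = refl
  beatsAll-map (just a) x = strictMono-<ᵇ a x

  run-map : ∀ m r xs → run (Maybe.map f m) r (map f xs) ≡ Maybe.map f (run m r xs)
  run-map m r       []       = refl
  run-map m (suc r) (x ∷ xs) rewrite updMax-map m x = run-map (updMax m x) r xs
  run-map m zero    (x ∷ xs) rewrite beatsAll-map m x | updMax-map m x with beatsAll m x
  ... | true  = refl
  ... | false = run-map (updMax m x) zero xs

runningMax : Maybe ℕ → List ℕ → Maybe ℕ
runningMax = foldl updMax

run-++ : ∀ m r xs ys →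
         run m r (xs ++ ys) ≡ run m r xs <∣> run (runningMax m xs) (r ∸ length xs) ys
run-++ m r       []       ys = refl
run-++ m (suc r) (x ∷ xs) ys = run-++ (updMax m x) r xs ys
run-++ m zero    (x ∷ xs) ys with beatsAll m x
... | true  = refl
... | false = trans (run-++ (updMax m x) zero xs ys)
                   (cong (λ r → run (updMax m x) zero xs <∣> run (runningMax (updMax m x) xs) r ys)
                         (0∸n≡0 (length xs)))

run-short : ∀ m r xs → length xs ≤ r → run m r xs ≡ nothing
run-short m r       []       _         = refl
run-short m (suc r) (x ∷ xs) (s≤s |xs|≤r) = run-short (updMax m x) r xs |xs|≤r

run-All : ∀ {P : ℕ → Set} m r {xs} → All P xs → MaybeAll.All P (run m r xs)
run-All m r       []         = MaybeAll.nothing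
run-All m (suc r) (_ ∷ pxs)  = run-All _ r pxs
run-All m zero    {x ∷ _} (px ∷ pxs) with beatsAll m x
... | true  = MaybeAll.just px
... | false = run-All _ zero pxs

updMax-< : ∀ {v} m x → MaybeAll.All (ℕ._< v) m → x ℕ.< v → MaybeAll.All (ℕ._< v) (updMax m x)
updMax-< nothing  x _                  x<v = MaybeAll.just x<v
updMax-< (just a) x (MaybeAll.just a<v) x<v with a <ᵇ x
... | true  = MaybeAll.just x<v
... | false = MaybeAll.just a<v

runningMax-< : ∀ {v} m xs → MaybeAll.All (ℕ._< v) m → All (ℕ._< v) xs →
               MaybeAll.All (ℕ._< v) (runningMax m xs)
runningMax-< m []       m<v []           = m<v
runningMax-< m (x ∷ xs) m<v (x<v ∷ xs<v) = runningMax-< (updMax m x) xs (updMax-< m x m<v x<v) xs<v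

beatsAll-< : ∀ {v} m → MaybeAll.All (ℕ._< v) m → beatsAll m v ≡ true
beatsAll-< nothing  _                  = refl
beatsAll-< (just a) (MaybeAll.just a<v) = <ᵇ-true a<v

updMax-≥ˡ : ∀ {v} m x → MaybeAny.Any (v ≤_) m → MaybeAny.Any (v ≤_) (updMax m x)
updMax-≥ˡ (just a) x (MaybeAny.just v≤a) with a <? x
... | yes a<x rewrite <ᵇ-true a<x = MaybeAny.just (≤-trans v≤a (<⇒≤ a<x))
... | no  a≮x rewrite <ᵇ-false a≮x = MaybeAny.just v≤a

updMax-≥ʳ : ∀ {v} m x → v ≤ x → MaybeAny.Any (v ≤_) (updMax m x)
updMax-≥ʳ nothing  x v≤x = MaybeAny.just v≤x
updMax-≥ʳ (just a) x v≤x with a <? x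
... | yes a<x rewrite <ᵇ-true a<x = MaybeAny.just v≤x
... | no  a≮x rewrite <ᵇ-false a≮x = MaybeAny.just (≤-trans v≤x (≮⇒≥ a≮x))

runningMax-≥ˡ : ∀ {v} m xs → MaybeAny.Any (v ≤_) m → MaybeAny.Any (v ≤_) (runningMax m xs)
runningMax-≥ˡ m []       v≤m = v≤m
runningMax-≥ˡ m (x ∷ xs) v≤m = runningMax-≥ˡ (updMax m x) xs (updMax-≥ˡ m x v≤m)

runningMax-≥ : ∀ {v x} m xs → v ≤ x → x ∈ xs → MaybeAny.Any (v ≤_) (runningMax m xs)
runningMax-≥ m (x ∷ xs) v≤x (here refl)  = runningMax-≥ˡ (updMax m x) xs (updMax-≥ʳ m x v≤x)
runningMax-≥ m (y ∷ xs) v≤x (there x∈xs) = runningMax-≥ (updMax m y) xs v≤x x∈xs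

beatsAll-≤ : ∀ {v} m → MaybeAny.Any (v ≤_) m → beatsAll m v ≡ false
beatsAll-≤ (just a) (MaybeAny.just v≤a) = <ᵇ-false (≤⇒≯ v≤a)

bump : ℕ → ℕ → ℕ
bump v y = if y <ᵇ v then y else suc y

bump-< : ∀ {v y} → y ℕ.< v → bump v y ≡ y
bump-< y<v rewrite <ᵇ-true y<v = refl

bump-≥ : ∀ {v y} → v ≤ y → bump v y ≡ suc y
bump-≥ v≤y rewrite <ᵇ-false (≤⇒≯ v≤y) = refl

bump-strictMono : ∀ v → bump v Preserves ℕ._<_ ⟶ ℕ._<_
bump-strictMono v {x} {y} x<y with x <? v | y <? v
... | yes x<v | yes y<v rewrite <ᵇ-true x<v | <ᵇ-true y<v = x<y
... | yes x<v | no  y≮v rewrite <ᵇ-true x<v | <ᵇ-false y≮v = m<n⇒m<1+n x<y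
... | no  x≮v | yes y<v = ⊥-elim (x≮v (<-trans x<y y<v))
... | no  x≮v | no  y≮v rewrite <ᵇ-false x≮v | <ᵇ-false y≮v = s≤s x<y

bump-≢ : ∀ v y → bump v y ≢ v
bump-≢ v y with y <? v
... | yes y<v rewrite <ᵇ-true y<v = <⇒≢ y<v
... | no  y≮v rewrite <ᵇ-false y≮v = λ 1+y≡v → y≮v (≤-reflexive 1+y≡v)

bump-suc-<ᵇ : ∀ v y → (suc v <ᵇ bump (suc v) y) ≡ (v <ᵇ y)
bump-suc-<ᵇ v y with y <? suc v
... | yes y<1+v rewrite <ᵇ-true y<1+v =
  trans (<ᵇ-false (≤⇒≯ (<⇒≤ y<1+v))) (sym (<ᵇ-false (≤⇒≯ (≤-pred y<1+v))))
... | no  y≮1+v rewrite <ᵇ-false y≮1+v = refl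

module _ {A B : Set} {P : B → Set} {Q : A → Set} (P? : Decidable P) (Q? : Decidable Q) (f : A → B) where

  length-filter-map : (∀ y → does (P? (f y)) ≡ does (Q? y)) →
                      ∀ xs → length (filter P? (map f xs)) ≡ length (filter Q? xs)
  length-filter-map P∘f≡Q []       = refl
  length-filter-map P∘f≡Q (y ∷ ys) with does (P? (f y)) | does (Q? y) | P∘f≡Q y
  ... | true  | .true  | refl = cong suc (length-filter-map P∘f≡Q ys)
  ... | false | .false | refl = length-filter-map P∘f≡Q ys

length-filter-++ : ∀ {A : Set} {P : A → Set} (P? : Decidable P) xs ys →
                   length (filter P? (xs ++ ys)) ≡ length (filter P? xs) ℕ.+ length (filter P? ys)
length-filter-++ P? xs ys = trans (cong length (filter-++ P? xs ys)) (length-++ (filter P? xs))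

inv-map : ∀ {f} → f Preserves ℕ._<_ ⟶ ℕ._<_ → ∀ xs → inv (map f xs) ≡ inv xs
inv-map f-mono []       = refl
inv-map {f} f-mono (x ∷ xs) =
  cong₂ ℕ._+_ (length-filter-map (_<? f x) (_<? x) f (λ y → strictMono-<ᵇ f-mono y x) xs)
              (inv-map f-mono xs)

inv-∷ʳ : ∀ xs v → inv (xs ∷ʳ v) ≡ inv xs ℕ.+ length (filter (v <?_) xs)
inv-∷ʳ []       v = refl
inv-∷ʳ (x ∷ xs) v = begin
  length (filter (_<? x) (xs ∷ʳ v)) ℕ.+ inv (xs ∷ʳ v)
    ≡⟨ cong₂ ℕ._+_ (length-filter-++ (_<? x) xs [ v ]) (inv-∷ʳ xs v) ⟩
  (length (filter (_<? x) xs) ℕ.+ v<x) ℕ.+ (inv xs ℕ.+ length (filter (v <?_) xs))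
    ≡⟨ +-interchange (length (filter (_<? x) xs)) v<x (inv xs) _ ⟩
  inv (x ∷ xs) ℕ.+ (v<x ℕ.+ length (filter (v <?_) xs))
    ≡⟨ cong (λ c → inv (x ∷ xs) ℕ.+ (c ℕ.+ length (filter (v <?_) xs))) v<x-symmetric ⟩
  inv (x ∷ xs) ℕ.+ (length (filter (v <?_) [ x ]) ℕ.+ length (filter (v <?_) xs))
    ≡⟨ cong (inv (x ∷ xs) ℕ.+_) (length-filter-++ (v <?_) [ x ] xs) ⟨
  inv (x ∷ xs) ℕ.+ length (filter (v <?_) (x ∷ xs)) ∎
  where
  open ≡-Reasoning
  v<x : ℕ
  v<x = length (filter (_<? x) [ v ])
  v<x-symmetric : v<x ≡ length (filter (v <?_) [ x ])
  v<x-symmetric with v <ᵇ x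
  ... | true  = refl
  ... | false = refl
  open import Algebra.Properties.CommutativeSemigroup +-commutativeSemigroup
    renaming (interchange to +-interchange)

range : ℕ → List ℕ
range = applyDownFrom suc

InRange : ℕ → ℕ → Set
InRange n y = 1 ≤ y × y ≤ n

∈-range⁻ : ∀ {n y} → y ∈ range n → InRange n y
∈-range⁻ y∈range with _ , i<n , refl ← ∈-applyDownFrom⁻ suc y∈range = s≤s z≤n , i<n

∈-range⁺ : ∀ {n y} → InRange n y → y ∈ range n
∈-range⁺ {y = suc i} (_ , i<n) = ∈-applyDownFrom⁺ suc i<n

range-unique : ∀ n → Unique (range n)
range-unique n =
  Unique.applyDownFrom⁺₁ suc n (λ j<i _ 1+i≡1+j → <⇒≢ j<i (sym (suc-injective 1+i≡1+j)))

length-filter-range : ∀ u n → length (filter (u <?_) (range n)) ≡ n ∸ u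
length-filter-range u zero = sym (0∸n≡0 u)
length-filter-range u (suc n) with u <? suc n
... | yes u<1+n rewrite <ᵇ-true u<1+n =
  trans (cong suc (length-filter-range u n)) (sym (+-∸-assoc 1 (≤-pred u<1+n)))
... | no  u≮1+n rewrite <ᵇ-false u≮1+n =
  trans (length-filter-range u n)
        (trans (m≤n⇒m∸n≡0 (≤-trans (n≤1+n n) (≮⇒≥ u≮1+n))) (sym (m≤n⇒m∸n≡0 (≮⇒≥ u≮1+n))))

record IsPerm (n : ℕ) (π : List ℕ) : Set where
  field
    length≡ : length π ≡ n
    bounded : All (InRange n) π
    unique  : Unique π

length-∷ʳ : ∀ {A : Set} (xs : List A) v → length (xs ∷ʳ v) ≡ suc (length xs)
length-∷ʳ xs v = trans (length-++ xs) (+-comm (length xs) 1)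

extend : ℕ → List ℕ → List ℕ
extend v σ = map (bump v) σ ∷ʳ v

unbump : ℕ → ℕ → ℕ
unbump v y = if y <ᵇ v then y else pred y

bump-unbump : ∀ v y → y ≢ v → bump v (unbump v y) ≡ y
bump-unbump v y y≢v with y <? v
... | yes y<v rewrite <ᵇ-true y<v = bump-< y<v
... | no  y≮v rewrite <ᵇ-false y≮v with y | ≤∧≢⇒< (≮⇒≥ y≮v) (y≢v ∘ sym)
...   | suc y′ | s≤s v≤y′ = bump-≥ v≤y′

unbump-InRange : ∀ {n v y} → InRange (suc n) v → InRange (suc n) y → y ≢ v →
                 InRange n (unbump v y)
unbump-InRange {v = v} {y} (1≤v , v≤1+n) (1≤y , y≤1+n) y≢v with y <? v
... | yes y<v rewrite <ᵇ-true y<v = 1≤y , ≤-pred (≤-trans y<v v≤1+n)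
... | no  y≮v rewrite <ᵇ-false y≮v with y | ≤∧≢⇒< (≮⇒≥ y≮v) (y≢v ∘ sym) | y≤1+n
...   | suc y′ | s≤s v≤y′ | s≤s y′≤n = ≤-trans 1≤v v≤y′ , y′≤n

bump-InRange : ∀ {n v y} → InRange n y → InRange (suc n) (bump v y)
bump-InRange {v = v} {y} (1≤y , y≤n) with y <? v
... | yes y<v rewrite <ᵇ-true y<v = 1≤y , m≤n⇒m≤1+n y≤n
... | no  y≮v rewrite <ᵇ-false y≮v = s≤s z≤n , s≤s y≤n

isPerm-extend⁺ : ∀ {n σ v} → IsPerm n σ → InRange (suc n) v → IsPerm (suc n) (extend v σ)
isPerm-extend⁺ {n} {σ} {v} σ-perm v∈[1,1+n] = record
  { length≡ = trans (length-∷ʳ (map (bump v) σ) v) (cong suc (trans (length-map (bump v) σ) length≡))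
  ; bounded = All.++⁺ (All.map⁺ (All.map (bump-InRange {v = v}) bounded)) (v∈[1,1+n] ∷ [])
  ; unique  = Unique.++⁺ (Unique.map⁺ (strictMono-injective (bump-strictMono v)) unique)
                         ([] AllPairs.∷ AllPairs.[]) v∉bumped
  }
  where
  open IsPerm σ-perm
  v∉bumped : ∀ {z} → ¬ (z ∈ map (bump v) σ × z ∈ [ v ])
  v∉bumped (z∈bumped , here refl) with _ , _ , z≡bump ← ∈-map⁻ (bump v) z∈bumped =
    bump-≢ v _ (sym z≡bump)

Unique-∷ʳ⁻ : ∀ {xs : List ℕ} {v} → Unique (xs ∷ʳ v) → Unique xs × All (_≢ v) xs
Unique-∷ʳ⁻ {xs} {v} xsv!
  with v≢xs AllPairs.∷ xs! ← Unique-resp-↭ (↭⇒↭ₛ (↭-sym (↭.∷↭∷ʳ v xs))) xsv! = xs! , All.map (_∘ sym) v≢xs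

isPerm-extend⁻ : ∀ {n π} → IsPerm (suc n) π →
                 ∃₂ λ σ v → IsPerm n σ × InRange (suc n) v × π ≡ extend v σ
isPerm-extend⁻ {n} {π} π-perm with initLast π
... | [] = ⊥-elim (0≢1+n (IsPerm.length≡ π-perm))
... | xs ∷ʳ′ v
  with xs! , xs≢v ← Unique-∷ʳ⁻ (IsPerm.unique π-perm)
  with xs∈[1,1+n] , v∈[1,1+n] ← All.∷ʳ⁻ (IsPerm.bounded π-perm) =
  map (unbump v) xs , v , σ-perm , v∈[1,1+n] , cong (_∷ʳ v) (sym bumped)
  where
  bumped : map (bump v) (map (unbump v) xs) ≡ xs
  bumped = trans (sym (map-∘ xs)) (map-id-local (All.map (bump-unbump v _) xs≢v))
  σ-perm : IsPerm n (map (unbump v) xs)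
  σ-perm = record
    { length≡ = trans (length-map (unbump v) xs)
                      (suc-injective (trans (sym (length-∷ʳ xs v)) (IsPerm.length≡ π-perm)))
    ; bounded = All.map⁺ (All.zipWith (λ (y∈ , y≢v) → unbump-InRange v∈[1,1+n] y∈ y≢v) (xs∈[1,1+n] , xs≢v))
    ; unique  = Unique.map⁻ (subst Unique (sym bumped) xs!)
    }

isPerm-complete : ∀ {n σ y} → IsPerm n σ → InRange n y → y ∈ σ
isPerm-complete {zero} _ (1≤y , y≤0) = ⊥-elim (<⇒≱ 1≤y y≤0)
isPerm-complete {suc n} {y = y} π-perm (1≤y , y≤1+n) with isPerm-extend⁻ π-perm
... | τ , v , τ-perm , (1≤v , v≤1+n) , refl with <-cmp y v
... | tri≈ _ refl _ = ∈-++⁺ʳ (map (bump v) τ) (here refl)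
... | tri< y<v _ _ = ∈-++⁺ˡ (subst (_∈ map (bump v) τ) (bump-< y<v)
        (∈-map⁺ (bump v) (isPerm-complete τ-perm (1≤y , ≤-pred (≤-trans y<v v≤1+n)))))
... | tri> _ _ v<y with y | v<y | y≤1+n
...   | suc y′ | s≤s v≤y′ | s≤s y′≤n = ∈-++⁺ˡ (subst (_∈ map (bump v) τ) (bump-≥ v≤y′)
        (∈-map⁺ (bump v) (isPerm-complete τ-perm (≤-trans 1≤v v≤y′ , y′≤n))))

isPerm⇒↭range : ∀ {n σ} → IsPerm n σ → σ ↭ range n
isPerm⇒↭range {n} σ-perm = unique∧set⇒↭ unique (range-unique n)
  (mk⇔ (λ z∈σ → ∈-range⁺ (All.lookup bounded z∈σ))
       (λ z∈range → isPerm-complete σ-perm (∈-range⁻ z∈range)))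
  where open IsPerm σ-perm

inv-extend : ∀ {n σ v} → IsPerm n σ → InRange (suc n) v → inv (extend v σ) ≡ inv σ ℕ.+ (suc n ∸ v)
inv-extend {n} {σ} {suc v} σ-perm _ = begin
  inv (map (bump (suc v)) σ ∷ʳ suc v)
    ≡⟨ inv-∷ʳ (map (bump (suc v)) σ) (suc v) ⟩
  inv (map (bump (suc v)) σ) ℕ.+ length (filter (suc v <?_) (map (bump (suc v)) σ))
    ≡⟨ cong₂ ℕ._+_ (inv-map (bump-strictMono (suc v)) σ)
                   (length-filter-map (suc v <?_) (v <?_) (bump (suc v)) (bump-suc-<ᵇ v) σ) ⟩
  inv σ ℕ.+ length (filter (v <?_) σ)
    ≡⟨ cong (inv σ ℕ.+_) (↭.↭-length (↭.filter-↭ (v <?_) (isPerm⇒↭range σ-perm))) ⟩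
  inv σ ℕ.+ length (filter (v <?_) (range n))
    ≡⟨ cong (inv σ ℕ.+_) (length-filter-range v n) ⟩
  inv σ ℕ.+ (n ∸ v) ∎
  where open ≡-Reasoning

module _ {m : ℕ} where

  ∈-allWords⁻ : ∀ n {w} → w ∈ allWords n m → length w ≡ n
  ∈-allWords⁻ zero    (here refl) = refl
  ∈-allWords⁻ (suc n) w∈
    with i , iw∈ ← Any.satisfied (∈-concatMap⁻ (λ i → map (i ∷_) (allWords n m)) {xs = allFin m} w∈)
    with _ , w′∈ , refl ← ∈-map⁻ (i ∷_) iw∈ = cong suc (∈-allWords⁻ n w′∈)

  ∈-allWords⁺ : ∀ n (w : List (Fin m)) → length w ≡ n → w ∈ allWords n m
  ∈-allWords⁺ zero    []      refl = here refl
  ∈-allWords⁺ (suc n) (i ∷ w) |w|≡1+n =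
    ∈-concatMap⁺ (λ i → map (i ∷_) (allWords n m))
      (lose (∈-allFin i) (∈-map⁺ (i ∷_) (∈-allWords⁺ n w (suc-injective |w|≡1+n))))

  allWords-unique : ∀ n → Unique (allWords n m)
  allWords-unique zero    = [] AllPairs.∷ AllPairs.[]
  allWords-unique (suc n) =
    Unique-concatMap⁺ (Unique.allFin⁺ m) (λ _ → Unique.map⁺ ∷-injectiveʳ (allWords-unique n)) same-head
    where
    same-head : ∀ {i j z} → z ∈ map (i ∷_) (allWords n m) → z ∈ map (j ∷_) (allWords n m) → i ≡ j
    same-head z∈i z∈j with _ , _ , refl ← ∈-map⁻ _ z∈i | _ , _ , z≡j∷ ← ∈-map⁻ _ z∈j = ∷-injectiveˡ z≡j∷

fromWord : ∀ {n} → List (Fin n) → List ℕ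
fromWord = map (suc ∘ toℕ)

toWord : ∀ {n} π → All (InRange n) π → List (Fin n)
toWord []      []                       = []
toWord (suc y ∷ π) ((_ , 1+y≤n) ∷ π∈) = fromℕ< 1+y≤n ∷ toWord π π∈

fromWord-toWord : ∀ {n} π (π∈ : All (InRange n) π) → fromWord (toWord π π∈) ≡ π
fromWord-toWord []          []       = refl
fromWord-toWord (suc y ∷ π) (_ ∷ π∈) = cong₂ _∷_ (cong suc (Fin.toℕ-fromℕ< _)) (fromWord-toWord π π∈)

fromWord-injective : ∀ {n} {v w : List (Fin n)} → fromWord v ≡ fromWord w → v ≡ w
fromWord-injective = map-injective (Fin.toℕ-injective ∘ suc-injective)

∈-perms⁻ : ∀ n {π} → π ∈ perms n → IsPerm n π
∈-perms⁻ n π∈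
  with w , w∈ , refl ← ∈-map⁻ fromWord π∈
  with w∈words , w! ← ∈-filter⁻ (UniqueDec.unique? Fin._≟_) {xs = allWords n n} w∈ = record
  { length≡ = trans (length-map (suc ∘ toℕ) w) (∈-allWords⁻ n w∈words)
  ; bounded = All.map⁺ (All.universal (λ i → s≤s z≤n , Fin.toℕ<n i) w)
  ; unique  = Unique.map⁺ (Fin.toℕ-injective ∘ suc-injective) w!
  }

∈-perms⁺ : ∀ n {π} → IsPerm n π → π ∈ perms n
∈-perms⁺ n {π} π-perm = subst (_∈ perms n) (fromWord-toWord π bounded)
  (∈-map⁺ fromWord (∈-filter⁺ (UniqueDec.unique? Fin._≟_) w∈words w!))
  where
  open IsPerm π-perm
  w : List (Fin n)
  w = toWord π bounded
  w! : Unique w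
  w! = Unique.map⁻ (subst Unique (sym (fromWord-toWord π bounded)) unique)
  w∈words : w ∈ allWords n n
  w∈words = ∈-allWords⁺ n w (trans (sym (length-map (suc ∘ toℕ) w))
                                    (trans (cong length (fromWord-toWord π bounded)) length≡))

perms-unique : ∀ n → Unique (perms n)
perms-unique n =
  Unique.map⁺ fromWord-injective (Unique.filter⁺ (UniqueDec.unique? Fin._≟_) (allWords-unique n))

extensions : ℕ → List ℕ → List (List ℕ)
extensions n σ = map (λ v → extend v σ) (range (suc n))

perms-suc↭ : ∀ n → perms (suc n) ↭ concatMap (extensions n) (perms n)
perms-suc↭ n = unique∧set⇒↭ (perms-unique (suc n))
  (Unique-concatMap⁺ (perms-unique n) extensions-unique extensions-disjoint)
  (mk⇔ decompose compose)
  where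
  extensions-unique : ∀ σ → Unique (extensions n σ)
  extensions-unique σ =
    Unique.map⁺ (λ {v} {w} e → proj₂ (∷ʳ-injective (map (bump v) σ) (map (bump w) σ) e))
                (range-unique (suc n))
  extensions-disjoint : ∀ {σ τ π} → π ∈ extensions n σ → π ∈ extensions n τ → σ ≡ τ
  extensions-disjoint {σ} {τ} π∈σ π∈τ
    with v , _ , refl ← ∈-map⁻ (λ v → extend v σ) π∈σ | w , _ , π≡ ← ∈-map⁻ (λ w → extend w τ) π∈τ
    with bσ≡bτ , refl ← ∷ʳ-injective (map (bump v) σ) (map (bump w) τ) π≡ =
    map-injective (strictMono-injective (bump-strictMono v)) bσ≡bτ
  decompose : ∀ {π} → π ∈ perms (suc n) → π ∈ concatMap (extensions n) (perms n)
  decompose π∈ with σ , v , σ-perm , v∈ , refl ← isPerm-extend⁻ (∈-perms⁻ (suc n) π∈) =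
    ∈-concatMap⁺ (extensions n) (lose (∈-perms⁺ n σ-perm) (∈-map⁺ (λ v → extend v σ) (∈-range⁺ v∈)))
  compose : ∀ {π} → π ∈ concatMap (extensions n) (perms n) → π ∈ perms (suc n)
  compose π∈ with σ , σ∈ , π∈σ ← find (∈-concatMap⁻ (extensions n) {xs = perms n} π∈)
             with v , v∈ , refl ← ∈-map⁻ (λ v → extend v σ) π∈σ =
    ∈-perms⁺ (suc n) (isPerm-extend⁺ (∈-perms⁻ n σ∈) (∈-range⁻ v∈))

sumℚ-perms-suc : ∀ (g : List ℕ → ℚ) n →
                 sumℚ g (perms (suc n)) ≡ sumℚ (λ σ → sumℚ (λ v → g (extend v σ)) (range (suc n))) (perms n)
sumℚ-perms-suc g n = begin
  sumℚ g (perms (suc n))                          ≡⟨ sumℚ-↭ g (perms-suc↭ n) ⟩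
  sumℚ g (concatMap (extensions n) (perms n))     ≡⟨ sumℚ-concatMap g (extensions n) (perms n) ⟩
  sumℚ (λ σ → sumℚ g (extensions n σ)) (perms n)
    ≡⟨ sumℚ-cong (perms n) (λ {σ} _ → sumℚ-map g (λ v → extend v σ) (range (suc n))) ⟩
  sumℚ (λ σ → sumℚ (λ v → g (extend v σ)) (range (suc n))) (perms n) ∎
  where open ≡-Reasoning

_≡ᵇjust_ : Maybe ℕ → ℕ → Bool
s ≡ᵇjust N = does (Maybe.≡-dec _≟_ s (just N))

<∣>-just-≡ᵇjust : ∀ {n} s → MaybeAll.All (_≤ n) s → ((s <∣> just (suc n)) ≡ᵇjust suc n) ≡ is-nothing s
<∣>-just-≡ᵇjust {n} nothing _ = dec-true (Maybe.≡-dec _≟_ (just (suc n)) (just (suc n))) refl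
<∣>-just-≡ᵇjust {n} (just y) (MaybeAll.just y≤n) =
  dec-false (Maybe.≡-dec _≟_ (just y) (just (suc n)))
            (λ y≡1+n → 1+n≰n (subst (_≤ n) (Maybe.just-injective y≡1+n) y≤n))

map-bump-≡ᵇjust : ∀ {n v} s → v ≤ n → MaybeAll.All (_≤ n) s →
                  (Maybe.map (bump v) s ≡ᵇjust suc n) ≡ (s ≡ᵇjust n)
map-bump-≡ᵇjust nothing v≤n _ = refl
map-bump-≡ᵇjust {n} {v} (just y) v≤n (MaybeAll.just y≤n) =
  does-⇔ (mk⇔ (cong just ∘ bumped-top ∘ Maybe.just-injective)
              (λ y≡n → cong just (trans (cong (bump v) (Maybe.just-injective y≡n)) (bump-≥ v≤n))))
         (Maybe.≡-dec _≟_ (just (bump v y)) (just (suc n))) (Maybe.≡-dec _≟_ (just y) (just n))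
  where
  bumped-top : bump v y ≡ suc n → y ≡ n
  bumped-top b≡1+n with y <? v
  ... | yes y<v rewrite <ᵇ-true y<v = ⊥-elim (1+n≰n (subst (_≤ n) b≡1+n y≤n))
  ... | no  y≮v rewrite <ᵇ-false y≮v = suc-injective b≡1+n

selectsNothing : ℕ → List ℕ → Bool
selectsNothing k π = is-nothing (select k π)

select-extend : ∀ k v σ → k ≤ length σ →
  select k (extend v σ) ≡
    Maybe.map (bump v) (select k σ) <∣> run (runningMax nothing (map (bump v) σ)) 0 [ v ]
select-extend k v σ k≤|σ| = begin
  run nothing k (map (bump v) σ ++ [ v ])
    ≡⟨ run-++ nothing k (map (bump v) σ) [ v ] ⟩
  run nothing k (map (bump v) σ) <∣> run max (k ∸ length (map (bump v) σ)) [ v ]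
    ≡⟨ cong₂ (λ s r → s <∣> run max r [ v ])
             (run-map (bump-strictMono v) nothing k σ)
             (m≤n⇒m∸n≡0 (subst (k ≤_) (sym (length-map (bump v) σ)) k≤|σ|)) ⟩
  Maybe.map (bump v) (select k σ) <∣> run max 0 [ v ] ∎
  where
  open ≡-Reasoning
  max : Maybe ℕ
  max = runningMax nothing (map (bump v) σ)

module _ {n σ k} (σ-perm : IsPerm n σ) (k≤n : k ≤ n) where
  open IsPerm σ-perm

  private
    k≤|σ| : k ≤ length σ
    k≤|σ| = subst (k ≤_) (sym length≡) k≤n

    selected≤n : MaybeAll.All (_≤ n) (select k σ)
    selected≤n = run-All nothing k (All.map proj₂ bounded)

  select-extend-top : select k (extend (suc n) σ) ≡ select k σ <∣> just (suc n)
  select-extend-top =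
    trans (select-extend k (suc n) σ k≤|σ|) (cong₂ _<∣>_ (unbumped (select k σ) selected≤n) accepted)
    where
    unbumped : ∀ s → MaybeAll.All (_≤ n) s → Maybe.map (bump (suc n)) s ≡ s
    unbumped nothing  _                   = refl
    unbumped (just y) (MaybeAll.just y≤n) = cong just (bump-< (s≤s y≤n))
    bumped<1+n : All (ℕ._< suc n) (map (bump (suc n)) σ)
    bumped<1+n =
      All.map⁺ (All.map (λ (_ , y≤n) → subst (ℕ._< suc n) (sym (bump-< (s≤s y≤n))) (s≤s y≤n)) bounded)
    accepted : run (runningMax nothing (map (bump (suc n)) σ)) 0 [ suc n ] ≡ just (suc n)
    accepted rewrite beatsAll-< _ (runningMax-< nothing _ MaybeAll.nothing bumped<1+n) = refl

  select-extend-below : ∀ {v} → InRange n v → select k (extend v σ) ≡ Maybe.map (bump v) (select k σ)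
  select-extend-below {v} (1≤v , v≤n) =
    trans (select-extend k v σ k≤|σ|)
          (trans (cong (Maybe.map (bump v) (select k σ) <∣>_) rejected) (Maybe.<∣>-identityʳ _))
    where
    1+n∈bumped : suc n ∈ map (bump v) σ
    1+n∈bumped = subst (_∈ map (bump v) σ) (bump-≥ v≤n)
                       (∈-map⁺ (bump v) (isPerm-complete σ-perm (≤-trans 1≤v v≤n , ≤-refl)))
    rejected : run (runningMax nothing (map (bump v) σ)) 0 [ v ] ≡ nothing
    rejected rewrite beatsAll-≤ _ (runningMax-≥ nothing _ (m≤n⇒m≤1+n v≤n) 1+n∈bumped) = refl

  winnable-extend-top : winnable? (suc n) k (extend (suc n) σ) ≡ selectsNothing k σ
  winnable-extend-top =
    trans (cong (_≡ᵇjust suc n) select-extend-top) (<∣>-just-≡ᵇjust (select k σ) selected≤n)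

  winnable-extend-below : ∀ {v} → InRange n v → winnable? (suc n) k (extend v σ) ≡ winnable? n k σ
  winnable-extend-below v∈ = trans (cong (_≡ᵇjust suc n) (select-extend-below v∈))
                                   (map-bump-≡ᵇjust (select k σ) (proj₂ v∈) selected≤n)

  selectsNothing-extend-top : selectsNothing k (extend (suc n) σ) ≡ false
  selectsNothing-extend-top rewrite select-extend-top with select k σ
  ... | nothing = refl
  ... | just _  = refl

  selectsNothing-extend-below : ∀ {v} → InRange n v → selectsNothing k (extend v σ) ≡ selectsNothing k σ
  selectsNothing-extend-below v∈ rewrite select-extend-below v∈ with select k σ
  ... | nothing = refl
  ... | just _  = refl

module _ (θ : ℚ) where
  open +-*-Solver

  pow-+ : ∀ a b → pow θ (a ℕ.+ b) ≡ pow θ a * pow θ b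
  pow-+ zero    b = sym (ℚ.*-identityˡ _)
  pow-+ (suc a) b = trans (cong (θ *_) (pow-+ a b)) (sym (ℚ.*-assoc θ _ _))

  qint-suc : ∀ n → qint θ (suc n) ≡ 1ℚ + θ * qint θ n
  qint-suc zero    = solve 1 (λ t → con 0ℚ :+ con 1ℚ := con 1ℚ :+ t :* con 0ℚ) refl θ
  qint-suc (suc n) = begin
    qint θ (suc n) + θ * pow θ n
      ≡⟨ cong (_+ θ * pow θ n) (qint-suc n) ⟩
    (1ℚ + θ * qint θ n) + θ * pow θ n
      ≡⟨ solve 3 (λ t q p → (con 1ℚ :+ t :* q) :+ t :* p := con 1ℚ :+ t :* (q :+ p))
               refl θ (qint θ n) (pow θ n) ⟩
    1ℚ + θ * (qint θ n + pow θ n) ∎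
    where open ≡-Reasoning

  sumℚ-pow-range : ∀ j n → sumℚ (λ v → pow θ (j ℕ.+ n ∸ v)) (range n) ≡ pow θ j * qint θ n
  sumℚ-pow-range j zero    = sym (ℚ.*-zeroʳ (pow θ j))
  sumℚ-pow-range j (suc n) = begin
    pow θ (j ℕ.+ suc n ∸ suc n) + sumℚ (λ v → pow θ (j ℕ.+ suc n ∸ v)) (range n)
      ≡⟨ cong₂ _+_ (cong (pow θ) (trans (cong (_∸ suc n) (+-suc j n)) (m+n∸n≡m j n)))
                   (trans (sumℚ-cong (range n) (λ {v} _ → cong (λ i → pow θ (i ∸ v)) (+-suc j n)))
                          (sumℚ-pow-range (suc j) n)) ⟩
    pow θ j + θ * pow θ j * qint θ n
      ≡⟨ solve 3 (λ p t q → p :+ t :* p :* q := p :* (con 1ℚ :+ t :* q)) refl (pow θ j) θ (qint θ n) ⟩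
    pow θ j * (1ℚ + θ * qint θ n)       ≡⟨ cong (pow θ j *_) (qint-suc n) ⟨
    pow θ j * qint θ (suc n)            ∎
    where open ≡-Reasoning

  weight : (List ℕ → Bool) → List ℕ → ℚ
  weight P π = if P π then pow θ (inv π) else 0ℚ

  invGF : (List ℕ → Bool) → ℕ → ℚ
  invGF P n = sumℚ (weight P) (perms n)

  weight-extend : ∀ {n σ v} (P Q : List ℕ → Bool) → IsPerm n σ → InRange (suc n) v →
                  P (extend v σ) ≡ Q σ → weight P (extend v σ) ≡ weight Q σ * pow θ (suc n ∸ v)
  weight-extend {n} {σ} {v} P Q σ-perm v∈ P≡Q =
    trans (cong (λ b → if b then pow θ (inv (extend v σ)) else 0ℚ) P≡Q) (by-cases (Q σ))
    where
    by-cases : ∀ b → (if b then pow θ (inv (extend v σ)) else 0ℚ) ≡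
                     (if b then pow θ (inv σ) else 0ℚ) * pow θ (suc n ∸ v)
    by-cases true  = trans (cong (pow θ) (inv-extend σ-perm v∈)) (pow-+ (inv σ) (suc n ∸ v))
    by-cases false = sym (ℚ.*-zeroˡ (pow θ (suc n ∸ v)))

  invGF-suc : ∀ (P Q R : List ℕ → Bool) n →
              (∀ {σ} → IsPerm n σ → P (extend (suc n) σ) ≡ Q σ) →
              (∀ {σ v} → IsPerm n σ → InRange n v → P (extend v σ) ≡ R σ) →
              invGF P (suc n) ≡ invGF Q n + invGF R n * (θ * qint θ n)
  invGF-suc P Q R n top below = begin
    invGF P (suc n)
      ≡⟨ sumℚ-perms-suc (weight P) n ⟩
    sumℚ (λ σ → sumℚ (λ v → weight P (extend v σ)) (range (suc n))) (perms n)
      ≡⟨ sumℚ-cong (perms n) (λ σ∈ → extensions-weight (∈-perms⁻ n σ∈)) ⟩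
    sumℚ (λ σ → weight Q σ + weight R σ * (θ * qint θ n)) (perms n)
      ≡⟨ sumℚ-+ (weight Q) _ (perms n) ⟩
    invGF Q n + sumℚ (λ σ → weight R σ * (θ * qint θ n)) (perms n)
      ≡⟨ cong (invGF Q n +_) (sumℚ-*ʳ (weight R) _ (perms n)) ⟩
    invGF Q n + invGF R n * (θ * qint θ n) ∎
    where
    open ≡-Reasoning
    extensions-weight : ∀ {σ} → IsPerm n σ →
      sumℚ (λ v → weight P (extend v σ)) (range (suc n)) ≡ weight Q σ + weight R σ * (θ * qint θ n)
    extensions-weight {σ} σ-perm = cong₂ _+_ new-maximum (begin
      sumℚ (λ v → weight P (extend v σ)) (range n)
        ≡⟨ sumℚ-cong (range n) (λ v∈ → let 1≤v , v≤n = ∈-range⁻ v∈ in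
             weight-extend P R σ-perm (1≤v , m≤n⇒m≤1+n v≤n) (below σ-perm (1≤v , v≤n))) ⟩
      sumℚ (λ v → weight R σ * pow θ (suc n ∸ v)) (range n)
        ≡⟨ sumℚ-*ˡ (weight R σ) _ (range n) ⟩
      weight R σ * sumℚ (λ v → pow θ (1 ℕ.+ n ∸ v)) (range n)
        ≡⟨ cong (weight R σ *_) (sumℚ-pow-range 1 n) ⟩
      weight R σ * (θ * 1ℚ * qint θ n)
        ≡⟨ cong (λ t → weight R σ * (t * qint θ n)) (ℚ.*-identityʳ θ) ⟩
      weight R σ * (θ * qint θ n) ∎)
      where
      new-maximum : weight P (extend (suc n) σ) ≡ weight Q σ
      new-maximum = trans (weight-extend P Q σ-perm (s≤s z≤n , ≤-refl) (top σ-perm))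
                          (trans (cong (λ i → weight Q σ * pow θ i) (n∸n≡0 n)) (ℚ.*-identityʳ _))

  invGF-all : ∀ n → invGF (const true) n ≡ qfact θ n
  invGF-all zero    = ℚ.+-identityʳ 1ℚ
  invGF-all (suc n) = begin
    invGF (const true) (suc n)
      ≡⟨ invGF-suc (const true) (const true) (const true) n (λ _ → refl) (λ _ _ → refl) ⟩
    F + F * (θ * qint θ n)
      ≡⟨ cong (λ x → x + x * (θ * qint θ n)) (invGF-all n) ⟩
    f + f * (θ * qint θ n)
      ≡⟨ solve 3 (λ f t q → f :+ f :* (t :* q) := (con 1ℚ :+ t :* q) :* f) refl f θ (qint θ n) ⟩
    (1ℚ + θ * qint θ n) * f
      ≡⟨ cong (_* f) (qint-suc n) ⟨
    qfact θ (suc n) ∎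
    where
    open ≡-Reasoning
    F f : ℚ
    F = invGF (const true) n
    f = qfact θ n

  -- W θ n k unfolds to invGF (winnable? n k) n.
  W-suc : ∀ n k → k ≤ n → W θ (suc n) k ≡ invGF (selectsNothing k) n + W θ n k * (θ * qint θ n)
  W-suc n k k≤n = invGF-suc (winnable? (suc n) k) (selectsNothing k) (winnable? n k) n
    (λ σ-perm → winnable-extend-top σ-perm k≤n) (λ σ-perm → winnable-extend-below σ-perm k≤n)

  W-diag : ∀ N → W θ N N ≡ 0ℚ
  W-diag N = trans (sumℚ-cong (perms N) λ {π} π∈ →
    cong (λ s → if s ≡ᵇjust N then pow θ (inv π) else 0ℚ)
         (run-short nothing N π (≤-reflexive (IsPerm.length≡ (∈-perms⁻ N π∈)))))
    (sumℚ-0 (perms N))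

  selectsNothing-suc : ∀ n k → k ≤ n →
                       invGF (selectsNothing k) (suc n) ≡ invGF (selectsNothing k) n * (θ * qint θ n)
  selectsNothing-suc n k k≤n = begin
    invGF (selectsNothing k) (suc n)
      ≡⟨ invGF-suc (selectsNothing k) (const false) (selectsNothing k) n
                   (λ σ-perm → selectsNothing-extend-top σ-perm k≤n)
                   (λ σ-perm → selectsNothing-extend-below σ-perm k≤n) ⟩
    sumℚ (λ _ → 0ℚ) (perms n) + R
      ≡⟨ trans (cong (_+ R) (sumℚ-0 (perms n))) (ℚ.+-identityˡ R) ⟩
    R ∎
    where
    open ≡-Reasoning
    R : ℚ
    R = invGF (selectsNothing k) n * (θ * qint θ n)

  selectsNothing-short : ∀ n k → n ≤ k → invGF (selectsNothing k) n ≡ invGF (const true) n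
  selectsNothing-short n k n≤k = sumℚ-cong (perms n) λ {π} π∈ →
    cong (λ s → if is-nothing s then pow θ (inv π) else 0ℚ)
         (run-short nothing k π (subst (_≤ k) (sym (IsPerm.length≡ (∈-perms⁻ n π∈))) n≤k))

  selectsNothing-closed : ∀ m k → k ≤ suc m →
    invGF (selectsNothing k) (suc m) ≡ pow θ (suc m ∸ k) * qint θ k * qfact θ m
  selectsNothing-closed-below : ∀ m k → k ≤ m →
    invGF (selectsNothing k) (suc m) ≡ pow θ (suc m ∸ k) * qint θ k * qfact θ m

  selectsNothing-closed m k k≤1+m with m≤n⇒m<n∨m≡n k≤1+m
  ... | inj₁ (s≤s k≤m) = selectsNothing-closed-below m k k≤m
  ... | inj₂ refl      = begin
    invGF (selectsNothing (suc m)) (suc m)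
      ≡⟨ selectsNothing-short (suc m) (suc m) ≤-refl ⟩
    invGF (const true) (suc m)
      ≡⟨ invGF-all (suc m) ⟩
    qint θ (suc m) * qfact θ m
      ≡⟨ cong (_* qfact θ m) (ℚ.*-identityˡ (qint θ (suc m))) ⟨
    1ℚ * qint θ (suc m) * qfact θ m
      ≡⟨ cong (λ i → pow θ i * qint θ (suc m) * qfact θ m) (n∸n≡0 m) ⟨
    pow θ (m ∸ m) * qint θ (suc m) * qfact θ m ∎
    where open ≡-Reasoning

  selectsNothing-closed-below zero    zero    z≤n = trans (selectsNothing-suc 0 0 z≤n)
    (solve 2 (λ z t → z :* (t :* con 0ℚ) := t :* con 1ℚ :* con 0ℚ :* con 1ℚ)
             refl (invGF (selectsNothing 0) 0) θ)
  selectsNothing-closed-below (suc m) k k≤1+m = begin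
    invGF (selectsNothing k) (suc (suc m))
      ≡⟨ selectsNothing-suc (suc m) k k≤1+m ⟩
    invGF (selectsNothing k) (suc m) * (θ * I)
      ≡⟨ cong (_* (θ * I)) (selectsNothing-closed m k k≤1+m) ⟩
    P * Q * R * (θ * I)
      ≡⟨ solve 5 (λ p q r t i → p :* q :* r :* (t :* i) := t :* p :* q :* (i :* r)) refl P Q R θ I ⟩
    θ * P * Q * (I * R)
      ≡⟨ cong (λ e → pow θ e * Q * (I * R)) (+-∸-assoc 1 k≤1+m) ⟨
    pow θ (suc (suc m) ∸ k) * Q * qfact θ (suc m) ∎
    where
    open ≡-Reasoning
    P Q R I : ℚ
    P = pow θ (suc m ∸ k)
    Q = qint θ k
    R = qfact θ m
    I = qint θ (suc m)

  W-recurrence : ∀ m k → k ≤ suc m →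
    W θ (2 ℕ.+ m) k ≡ θ * qint θ (suc m) * W θ (suc m) k + pow θ (suc m ∸ k) * qint θ k * qfact θ m
  W-recurrence m k k≤1+m = begin
    W θ (2 ℕ.+ m) k
      ≡⟨ W-suc (suc m) k k≤1+m ⟩
    invGF (selectsNothing k) (suc m) + Wm * (θ * I)
      ≡⟨ cong (_+ Wm * (θ * I)) (selectsNothing-closed m k k≤1+m) ⟩
    Z + Wm * (θ * I)
      ≡⟨ solve 4 (λ z w t i → z :+ w :* (t :* i) := t :* i :* w :+ z) refl Z Wm θ I ⟩
    θ * I * Wm + Z ∎
    where
    open ≡-Reasoning
    Wm I Z : ℚ
    Wm = W θ (suc m) k
    I  = qint θ (suc m)
    Z  = pow θ (suc m ∸ k) * qint θ k * qfact θ m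

theorem6p3 : (θ : ℚ) → 0ℚ < θ →
    (W θ 1 0 ≡ 1ℚ)
    × ((N : ℕ) → 1 ≤ N → W θ N N ≡ 0ℚ)
    × ((N k : ℕ) → 2 ≤ N → k ≤ N ∸ 1 →
    W θ N k ≡ θ * qint θ (N ∸ 1) * W θ (N ∸ 1) k
    + pow θ (N ∸ k ∸ 1) * qint θ k * qfact θ (N ∸ 2))
theorem6p3 θ _ = ℚ.+-identityʳ 1ℚ , (λ N _ → W-diag θ N) , recurrence
  where
  recurrence : (N k : ℕ) → 2 ≤ N → k ≤ N ∸ 1 →
    W θ N k ≡ θ * qint θ (N ∸ 1) * W θ (N ∸ 1) k + pow θ (N ∸ k ∸ 1) * qint θ k * qfact θ (N ∸ 2)
  recurrence (suc (suc m)) k (s≤s (s≤s z≤n)) k≤1+m =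
    trans (W-recurrence θ m k k≤1+m)
          (cong (λ e → θ * qint θ (suc m) * W θ (suc m) k + pow θ e * qint θ k * qfact θ m)
                (sym (trans (∸-+-assoc (2 ℕ.+ m) k 1) (cong (2 ℕ.+ m ∸_) (+-comm k 1)))))
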